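{- Let $G$ be a finite abelian group with $|G|=m$ and let $A\subseteq G$. Then for every positive integer $k$, $$\sum_{g\in G}\big(R_A(g)-k\big)^2\ \ge\ km-(2k-1)|A|+k^2-k.$$
   Context: For a subset $A$ of an abelian group $G$ (written additively) and $g\in G$, $R_A(g)$ denotes the number of ordered pairs $(a,a')\in A\times A$ with $a+a'=g$. -}

module Defs where

open import Data.Bool using (Bool; true; false; _∧_; if_then_else_)
open import Data.Nat using (ℕ)
open import Data.Fin using (Fin; _≟_)
open import Data.Fin.Subset using (Subset)
open import Data.Vec using (lookup)
open import Data.List using (List; map; allFin; foldr)
open import Data.Nat.ListAction using (sum)
open import Data.Integer using (ℤ) renaming (_+_ to _+ℤ_)
import Data.Integer as ℤ
open import Relation.Nullary.Decidable using (⌊_⌋)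

Σ-Fin : (m : ℕ) → (Fin m → ℕ) → ℕ
Σ-Fin m f = sum (map f (allFin m))

R : {m : ℕ} → (Fin m → Fin m → Fin m) → Subset m → Fin m → ℕ
R {m} _+_ A g =
  Σ-Fin m λ a → Σ-Fin m λ a' →
    if lookup A a ∧ lookup A a' ∧ ⌊ (a + a') ≟ g ⌋ then 1 else 0

Σℤ-Fin : (m : ℕ) → (Fin m → ℤ) → ℤ
Σℤ-Fin m f = foldr _+ℤ_ (ℤ.+ 0) (map f (allFin m))

-- Write n = |A|, r = R_A and D(h) = #{(a , c) ∈ A × A : a - c = h}.  Both r and D
-- sum to n², and Σ r² = Σ D², because a + b = c + d exactly when a - c = d - b;
-- moreover D(0) = n.  Expanding the squares therefore gives
--   Σ (r - k)² = Σ (D - k)(D - k + 1) + km - n².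
-- Each (D(h) - k)(D(h) - k + 1) is a product of consecutive integers, hence
-- nonnegative, and keeping only the term h = 0 leaves
-- (n - k)(n - k + 1) + km - n² = km - (2k - 1)n + k² - k.
module Submission where

open import Defs
open import Data.Nat using (ℕ; _≤_; _∸_)
open import Data.Fin using (Fin)
open import Data.Fin.Subset using (Subset; ∣_∣)
open import Data.Integer using (ℤ; +_; _+_; _-_; _*_)
open import Algebra.Structures using (IsAbelianGroup)
open import Relation.Binary.PropositionalEquality using (_≡_)
import Data.Nat as ℕ
import Data.Integer as ℤ

open import Algebra.Bundles using (AbelianGroup)
open import Algebra.Core using (Op₁; Op₂)
import Algebra.Properties.AbelianGroup as AbelianGroupProperties
import Data.Integer.Properties as ℤP
open import Algebra.Properties.Semiring.Sum ℤP.+-*-semiring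
  using (sum; sum-syntax; sum-cong-≗; sum-remove; sum-replicate-zero; ∑-comm; ∑-distrib-+;
         *-distribˡ-sum; *-distribʳ-sum)
open import Data.Bool using (Bool; true; false; _∧_; if_then_else_)
open import Data.Fin using (zero; suc; punchIn; _≟_)
open import Data.Fin.Properties using (punchInᵢ≢i)
open import Data.Integer using (-_; -[1+_]; +≤+; 0ℤ; 1ℤ)
open import Data.Integer.Tactic.RingSolver using (solve-∀)
open import Data.List using (List; []; _∷_; map; allFin; foldr; tabulate)
open import Data.List.Properties using (map-tabulate; map-∘)
import Data.Nat.ListAction as List
import Data.Nat.Properties as ℕP
open import Data.Vec using (lookup)
import Data.Vec as Vec
open import Data.Vec.Functional using (removeAt)
open import Function using (_∘_; _⇔_; mk⇔)
open import Relation.Binary.PropositionalEquality using (refl; sym; trans; cong; cong₂; module ≡-Reasoning)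
open import Relation.Nullary using (¬_; does)
open import Relation.Nullary.Decidable using (⌊_⌋; isYes≗does; dec-true; dec-false; does-⇔)

∑-const : ∀ m (c : ℤ) → ∑[ i < m ] c ≡ c * + m
∑-const ℕ.zero    c = sym (ℤP.*-zeroʳ c)
∑-const (ℕ.suc m) c = trans (cong (_+_ c) (∑-const m c)) (sym (ℤP.*-suc c (+ m)))

∑-*-∑ : ∀ {m n} (f : Fin m → ℤ) (g : Fin n → ℤ) → sum f * sum g ≡ ∑[ i < m ] ∑[ j < n ] (f i * g j)
∑-*-∑ f g = trans (*-distribʳ-sum (sum g) f) (sum-cong-≗ λ i → *-distribˡ-sum (f i) g)

∑∑-*-∑∑ : ∀ {m} (f h : Fin m → Fin m → ℤ) →
  (∑[ a < m ] ∑[ b < m ] f a b) * (∑[ c < m ] ∑[ d < m ] h c d)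
    ≡ ∑[ a < m ] ∑[ b < m ] ∑[ c < m ] ∑[ d < m ] (f a b * h c d)
∑∑-*-∑∑ {m} f h = trans (∑-*-∑ (λ a → ∑[ b < m ] f a b) (λ c → ∑[ d < m ] h c d)) (sum-cong-≗ λ a →
  trans (sum-cong-≗ λ c → ∑-*-∑ (f a) (h c)) (∑-comm (λ c b → ∑[ d < m ] (f a b * h c d))))

∑-comm₄ : ∀ {m} (T : Fin m → Fin m → Fin m → Fin m → Fin m → ℤ) →
  ∑[ g < m ] ∑[ a < m ] ∑[ b < m ] ∑[ c < m ] ∑[ d < m ] T g a b c d
    ≡ ∑[ a < m ] ∑[ b < m ] ∑[ c < m ] ∑[ d < m ] ∑[ g < m ] T g a b c d
∑-comm₄ {m} T =
  trans (∑-comm (λ g a → ∑[ b < m ] ∑[ c < m ] ∑[ d < m ] T g a b c d)) (sum-cong-≗ λ a →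
  trans (∑-comm (λ g b → ∑[ c < m ] ∑[ d < m ] T g a b c d)) (sum-cong-≗ λ b →
  trans (∑-comm (λ g c → ∑[ d < m ] T g a b c d)) (sum-cong-≗ λ c →
  ∑-comm (λ g d → T g a b c d))))

∑-quadratic : ∀ {m} (f : Fin m → ℤ) (b c : ℤ) →
  ∑[ i < m ] (f i * f i + b * f i + c) ≡ ∑[ i < m ] (f i * f i) + b * sum f + c * + m
∑-quadratic {m} f b c = begin
  ∑[ i < m ] (f i * f i + b * f i + c)
    ≡⟨ ∑-distrib-+ (λ i → f i * f i + b * f i) (λ _ → c) ⟩
  ∑[ i < m ] (f i * f i + b * f i) + ∑[ i < m ] c
    ≡⟨ cong₂ _+_ (∑-distrib-+ (λ i → f i * f i) (λ i → b * f i)) (∑-const m c) ⟩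
  ∑[ i < m ] (f i * f i) + ∑[ i < m ] (b * f i) + c * + m
    ≡⟨ cong (λ t → ∑[ i < m ] (f i * f i) + t + c * + m) (*-distribˡ-sum b f) ⟨
  ∑[ i < m ] (f i * f i) + b * sum f + c * + m
    ∎
  where open ≡-Reasoning

∑-nonneg : ∀ {m} (f : Fin m → ℤ) → (∀ i → 0ℤ ℤ.≤ f i) → 0ℤ ℤ.≤ sum f
∑-nonneg {ℕ.zero}  f f≥0 = ℤP.≤-refl
∑-nonneg {ℕ.suc m} f f≥0 = ℤP.+-mono-≤ (f≥0 zero) (∑-nonneg (f ∘ suc) (f≥0 ∘ suc))

term≤∑ : ∀ {m} (f : Fin m → ℤ) → (∀ i → 0ℤ ℤ.≤ f i) → ∀ i → f i ℤ.≤ sum f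
term≤∑ {ℕ.suc m} f f≥0 i = begin
  f i                        ≡⟨ ℤP.+-identityʳ (f i) ⟨
  f i + 0ℤ                   ≤⟨ ℤP.+-monoʳ-≤ (f i) (∑-nonneg (removeAt f i) (f≥0 ∘ punchIn i)) ⟩
  f i + sum (removeAt f i)   ≡⟨ sum-remove f ⟨
  sum f                      ∎
  where open ℤP.≤-Reasoning

consecutive-*-nonneg : ∀ z → 0ℤ ℤ.≤ z * (z + 1ℤ)
consecutive-*-nonneg (+ n)    = ℤP.≤-trans (+≤+ ℕ.z≤n) (ℤP.≤-reflexive (ℤP.pos-* n (n ℕ.+ 1)))
consecutive-*-nonneg -[1+ n ] = ℤP.≤-trans (consecutive-*-nonneg (+ n)) (ℤP.≤-reflexive (reflect -[1+ n ]))
  where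
  reflect : ∀ z → (- z - 1ℤ) * (- z - 1ℤ + 1ℤ) ≡ z * (z + 1ℤ)
  reflect = solve-∀

χ : Bool → ℤ
χ b = + (if b then 1 else 0)

χ-∧ : ∀ a b → χ (a ∧ b) ≡ χ a * χ b
χ-∧ true  b = sym (ℤP.*-identityˡ (χ b))
χ-∧ false b = refl

χ-idem : ∀ b → χ b * χ b ≡ χ b
χ-idem true  = refl
χ-idem false = refl

δ : ∀ {m} → Fin m → Fin m → ℤ
δ x y = χ ⌊ x ≟ y ⌋

δ-refl : ∀ {m} (x : Fin m) → δ x x ≡ 1ℤ
δ-refl x = cong χ (trans (isYes≗does (x ≟ x)) (dec-true (x ≟ x) refl))

δ-≢ : ∀ {m} {x y : Fin m} → ¬ x ≡ y → δ x y ≡ 0ℤ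
δ-≢ {x = x} {y} x≢y = cong χ (trans (isYes≗does (x ≟ y)) (dec-false (x ≟ y) x≢y))

δ-cong : ∀ {m n} {x y : Fin m} {u v : Fin n} → (x ≡ y ⇔ u ≡ v) → δ x y ≡ δ u v
δ-cong {x = x} {y} {u} {v} x≡y⇔u≡v = cong χ (begin
  ⌊ x ≟ y ⌋     ≡⟨ isYes≗does (x ≟ y) ⟩
  does (x ≟ y)  ≡⟨ does-⇔ x≡y⇔u≡v (x ≟ y) (u ≟ v) ⟩
  does (u ≟ v)  ≡⟨ isYes≗does (u ≟ v) ⟨
  ⌊ u ≟ v ⌋     ∎)
  where open ≡-Reasoning

δ-sym : ∀ {m} (x y : Fin m) → δ x y ≡ δ y x
δ-sym x y = δ-cong (mk⇔ sym sym)

∑-δ-* : ∀ {m} (x : Fin m) (f : Fin m → ℤ) → ∑[ g < m ] (δ x g * f g) ≡ f x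
∑-δ-* {ℕ.suc m} x f = begin
  ∑[ g < ℕ.suc m ] (δ x g * f g)                                  ≡⟨ sum-remove {i = x} (λ g → δ x g * f g) ⟩
  δ x x * f x + ∑[ j < m ] (δ x (punchIn x j) * f (punchIn x j))  ≡⟨ cong₂ _+_ (cong (_* f x) (δ-refl x)) (sum-cong-≗ vanish) ⟩
  1ℤ * f x + ∑[ j < m ] 0ℤ                                        ≡⟨ cong₂ _+_ (ℤP.*-identityˡ (f x)) (sum-replicate-zero m) ⟩
  f x + 0ℤ                                                        ≡⟨ ℤP.+-identityʳ (f x) ⟩
  f x                                                             ∎
  where
  open ≡-Reasoning
  vanish : ∀ j → δ x (punchIn x j) * f (punchIn x j) ≡ 0ℤ
  vanish j = cong (_* f (punchIn x j)) (δ-≢ (punchInᵢ≢i x j ∘ sym))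

∑-δ : ∀ {m} (x : Fin m) → ∑[ g < m ] δ x g ≡ 1ℤ
∑-δ x = trans (sum-cong-≗ λ g → sym (ℤP.*-identityʳ (δ x g))) (∑-δ-* x (λ _ → 1ℤ))

module _ {c ℓ} (G : AbelianGroup c ℓ) where
  open AbelianGroup G using (_≈_; _∙_; setoid; assoc; comm; ∙-congˡ; ∙-congʳ) renaming (_-_ to _//_)
  open AbelianGroupProperties G using (//-rightDividesˡ; ∙-cancelʳ)
  open import Relation.Binary.Reasoning.Setoid setoid

  //-∙-cancel : ∀ x y z → (x // y) ∙ (y ∙ z) ≈ x ∙ z
  //-∙-cancel x y z = begin
    (x // y) ∙ (y ∙ z)  ≈⟨ assoc (x // y) y z ⟨
    (x // y) ∙ y ∙ z    ≈⟨ ∙-congʳ (//-rightDividesˡ y x) ⟩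
    x ∙ z               ∎

  ∙≈∙⇔//≈// : ∀ a b c d → (a ∙ b ≈ c ∙ d) ⇔ (a // c ≈ d // b)
  ∙≈∙⇔//≈// a b c d = mk⇔
    (λ ab≈cd → ∙-cancelʳ (b ∙ c) _ _ (begin
      (a // c) ∙ (b ∙ c)  ≈⟨ ac ⟩
      a ∙ b               ≈⟨ ab≈cd ⟩
      c ∙ d               ≈⟨ db ⟨
      (d // b) ∙ (b ∙ c)  ∎))
    (λ ac≈db → begin
      a ∙ b               ≈⟨ ac ⟨
      (a // c) ∙ (b ∙ c)  ≈⟨ ∙-congʳ ac≈db ⟩
      (d // b) ∙ (b ∙ c)  ≈⟨ db ⟩
      c ∙ d               ∎)
    where
    ac : (a // c) ∙ (b ∙ c) ≈ a ∙ b
    ac = begin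
      (a // c) ∙ (b ∙ c)  ≈⟨ ∙-congˡ (comm b c) ⟩
      (a // c) ∙ (c ∙ b)  ≈⟨ //-∙-cancel a c b ⟩
      a ∙ b               ∎
    db : (d // b) ∙ (b ∙ c) ≈ c ∙ d
    db = begin
      (d // b) ∙ (b ∙ c)  ≈⟨ //-∙-cancel d b c ⟩
      d ∙ c               ≈⟨ comm d c ⟩
      c ∙ d               ∎

-- With w the indicator of A, rep _∙_ is R_A and rep _//_ counts representations as differences.
module Representation {m : ℕ} (w : Fin m → ℤ) where

  rep : (Fin m → Fin m → Fin m) → Fin m → ℤ
  rep u g = ∑[ a < m ] ∑[ b < m ] (w a * w b * δ (u a b) g)

  ∑-rep : ∀ u → ∑[ g < m ] rep u g ≡ sum w * sum w
  ∑-rep u = begin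
    ∑[ g < m ] ∑[ a < m ] ∑[ b < m ] (w a * w b * δ (u a b) g)
      ≡⟨ ∑-comm (λ g a → ∑[ b < m ] (w a * w b * δ (u a b) g)) ⟩
    ∑[ a < m ] ∑[ g < m ] ∑[ b < m ] (w a * w b * δ (u a b) g)
      ≡⟨ sum-cong-≗ (λ a → ∑-comm (λ g b → w a * w b * δ (u a b) g)) ⟩
    ∑[ a < m ] ∑[ b < m ] ∑[ g < m ] (w a * w b * δ (u a b) g)
      ≡⟨ (sum-cong-≗ λ a → sum-cong-≗ λ b → count a b) ⟩
    ∑[ a < m ] ∑[ b < m ] (w a * w b)
      ≡⟨ ∑-*-∑ w w ⟨
    sum w * sum w
      ∎
    where
    open ≡-Reasoning
    count : ∀ a b → ∑[ g < m ] (w a * w b * δ (u a b) g) ≡ w a * w b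
    count a b = begin
      ∑[ g < m ] (w a * w b * δ (u a b) g)  ≡⟨ *-distribˡ-sum (w a * w b) (δ (u a b)) ⟨
      w a * w b * ∑[ g < m ] δ (u a b) g    ≡⟨ cong (_*_ (w a * w b)) (∑-δ (u a b)) ⟩
      w a * w b * 1ℤ                        ≡⟨ ℤP.*-identityʳ (w a * w b) ⟩
      w a * w b                             ∎

  ∑-rep-* : ∀ u v → ∑[ g < m ] (rep u g * rep v g)
    ≡ ∑[ a < m ] ∑[ b < m ] ∑[ c < m ] ∑[ d < m ] (w a * w b * (w c * w d) * δ (u a b) (v c d))
  ∑-rep-* u v = begin
    ∑[ g < m ] (rep u g * rep v g)
      ≡⟨ sum-cong-≗ (λ g → ∑∑-*-∑∑ (λ a b → w a * w b * δ (u a b) g) (λ c d → w c * w d * δ (v c d) g)) ⟩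
    ∑[ g < m ] ∑[ a < m ] ∑[ b < m ] ∑[ c < m ] ∑[ d < m ] (w a * w b * δ (u a b) g * (w c * w d * δ (v c d) g))
      ≡⟨ ∑-comm₄ (λ g a b c d → w a * w b * δ (u a b) g * (w c * w d * δ (v c d) g)) ⟩
    ∑[ a < m ] ∑[ b < m ] ∑[ c < m ] ∑[ d < m ] ∑[ g < m ] (w a * w b * δ (u a b) g * (w c * w d * δ (v c d) g))
      ≡⟨ (sum-cong-≗ λ a → sum-cong-≗ λ b → sum-cong-≗ λ c → sum-cong-≗ λ d → coincide a b c d) ⟩
    ∑[ a < m ] ∑[ b < m ] ∑[ c < m ] ∑[ d < m ] (w a * w b * (w c * w d) * δ (u a b) (v c d))
      ∎
    where
    open ≡-Reasoning
    regroup : ∀ p q s t → p * s * (q * t) ≡ p * q * (s * t)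
    regroup = solve-∀
    coincide : ∀ a b c d → ∑[ g < m ] (w a * w b * δ (u a b) g * (w c * w d * δ (v c d) g))
                           ≡ w a * w b * (w c * w d) * δ (u a b) (v c d)
    coincide a b c d = begin
      ∑[ g < m ] (w a * w b * δ x g * (w c * w d * δ y g))  ≡⟨ sum-cong-≗ (λ g → regroup (w a * w b) (w c * w d) (δ x g) (δ y g)) ⟩
      ∑[ g < m ] (W * (δ x g * δ y g))                      ≡⟨ *-distribˡ-sum W (λ g → δ x g * δ y g) ⟨
      W * ∑[ g < m ] (δ x g * δ y g)                        ≡⟨ cong (_*_ W) (trans (∑-δ-* x (δ y)) (δ-sym y x)) ⟩
      W * δ x y                                             ∎
      where
      x = u a b
      y = v c d
      W = w a * w b * (w c * w d)

module Difference {m : ℕ} {_∙_ : Op₂ (Fin m)} {ε : Fin m} {_⁻¹ : Op₁ (Fin m)}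
  (isAbelianGroup : IsAbelianGroup _≡_ _∙_ ε _⁻¹) (w : Fin m → ℤ) where

  G : AbelianGroup _ _
  G = record { isAbelianGroup = isAbelianGroup }

  _//_ : Op₂ (Fin m)
  x // y = x ∙ (y ⁻¹)

  open AbelianGroupProperties G using (x∙y⁻¹≈ε⇒x≈y; x≈y⇒x∙y⁻¹≈ε)
  open Representation w

  rep-//-ε : rep _//_ ε ≡ ∑[ a < m ] (w a * w a)
  rep-//-ε = sum-cong-≗ λ a → begin
    ∑[ b < m ] (w a * w b * δ (a // b) ε)
      ≡⟨ sum-cong-≗ (λ b → cong₂ _*_ (ℤP.*-comm (w a) (w b)) (δ-cong (mk⇔ (x∙y⁻¹≈ε⇒x≈y a b) x≈y⇒x∙y⁻¹≈ε))) ⟩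
    ∑[ b < m ] (w b * w a * δ a b)
      ≡⟨ sum-cong-≗ (λ b → ℤP.*-comm (w b * w a) (δ a b)) ⟩
    ∑[ b < m ] (δ a b * (w b * w a))
      ≡⟨ ∑-δ-* a (λ b → w b * w a) ⟩
    w a * w a
      ∎
    where open ≡-Reasoning

  ∑rep∙²≡∑rep//² : ∑[ g < m ] (rep _∙_ g * rep _∙_ g) ≡ ∑[ g < m ] (rep _//_ g * rep _//_ g)
  ∑rep∙²≡∑rep//² = begin
    ∑[ g < m ] (rep _∙_ g * rep _∙_ g)
      ≡⟨ ∑-rep-* _∙_ _∙_ ⟩
    ∑[ a < m ] ∑[ b < m ] ∑[ c < m ] ∑[ d < m ] (w a * w b * (w c * w d) * δ (a ∙ b) (c ∙ d))
      ≡⟨ (sum-cong-≗ λ a → sum-cong-≗ λ b → sum-cong-≗ λ c → sum-cong-≗ λ d →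
           cong₂ _*_ (regroup (w a) (w b) (w c) (w d)) (δ-cong (∙≈∙⇔//≈// G a b c d))) ⟩
    ∑[ a < m ] ∑[ b < m ] ∑[ c < m ] ∑[ d < m ] (w a * w c * (w d * w b) * δ (a // c) (d // b))
      ≡⟨ sum-cong-≗ (λ a → rotate λ b c d → w a * w c * (w d * w b) * δ (a // c) (d // b)) ⟩
    ∑[ a < m ] ∑[ c < m ] ∑[ d < m ] ∑[ b < m ] (w a * w c * (w d * w b) * δ (a // c) (d // b))
      ≡⟨ ∑-rep-* _//_ _//_ ⟨
    ∑[ g < m ] (rep _//_ g * rep _//_ g)
      ∎
    where
    open ≡-Reasoning
    regroup : ∀ p q r s → p * q * (r * s) ≡ p * r * (s * q)
    regroup = solve-∀
    rotate : (F : Fin m → Fin m → Fin m → ℤ) →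
      ∑[ b < m ] ∑[ c < m ] ∑[ d < m ] F b c d ≡ ∑[ c < m ] ∑[ d < m ] ∑[ b < m ] F b c d
    rotate F = trans (∑-comm (λ b c → ∑[ d < m ] F b c d)) (sum-cong-≗ λ c → ∑-comm (λ b d → F b c d))

∑-shifted-product : ∀ {m} (f : Fin m → ℤ) (K e : ℤ) →
  ∑[ i < m ] ((f i - K) * (f i - K + e))
    ≡ ∑[ i < m ] (f i * f i) + (e - + 2 * K) * sum f + (K * K - e * K) * + m
∑-shifted-product f K e = trans (sum-cong-≗ λ i → expand (f i) K e) (∑-quadratic f (e - + 2 * K) (K * K - e * K))
  where
  expand : ∀ x K e → (x - K) * (x - K + e) ≡ x * x + (e - + 2 * K) * x + (K * K - e * K)
  expand = solve-∀

-- s plays the role of the difference representation function, z that of the identity.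
sq-deviation-bound : ∀ {m} (r s : Fin m → ℤ) (N K : ℤ) (z : Fin m) →
  sum r ≡ N * N → sum s ≡ N * N →
  ∑[ g < m ] (r g * r g) ≡ ∑[ g < m ] (s g * s g) → s z ≡ N →
  K * + m - (+ 2 * K - 1ℤ) * N + K * K - K ℤ.≤ ∑[ g < m ] ((r g - K) * (r g - K))
sq-deviation-bound {m} r s N K z ∑r≡N² ∑s≡N² ∑r²≡∑s² sz≡N = begin
  K * M - (+ 2 * K - 1ℤ) * N + K * K - K
    ≡⟨ complete-square N K M ⟩
  (N - K) * (N - K + 1ℤ) + (K * M - N * N)
    ≡⟨ cong (λ x → (x - K) * (x - K + 1ℤ) + (K * M - N * N)) sz≡N ⟨
  t z + (K * M - N * N)
    ≤⟨ ℤP.+-monoˡ-≤ (K * M - N * N) (term≤∑ t (λ g → consecutive-*-nonneg (s g - K)) z) ⟩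
  sum t + (K * M - N * N)
    ≡⟨ cong (_+ (K * M - N * N)) (∑-shifted-product s K 1ℤ) ⟩
  ∑[ g < m ] (s g * s g) + (1ℤ - + 2 * K) * sum s + (K * K - 1ℤ * K) * M + (K * M - N * N)
    ≡⟨ cong₂ (λ x y → x + (1ℤ - + 2 * K) * y + (K * K - 1ℤ * K) * M + (K * M - N * N)) (sym ∑r²≡∑s²) ∑s≡N² ⟩
  E + (1ℤ - + 2 * K) * (N * N) + (K * K - 1ℤ * K) * M + (K * M - N * N)
    ≡⟨ recombine E N K M ⟩
  E + (0ℤ - + 2 * K) * (N * N) + (K * K - 0ℤ * K) * M
    ≡⟨ cong (λ y → E + (0ℤ - + 2 * K) * y + (K * K - 0ℤ * K) * M) ∑r≡N² ⟨
  E + (0ℤ - + 2 * K) * sum r + (K * K - 0ℤ * K) * M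
    ≡⟨ ∑-shifted-product r K 0ℤ ⟨
  ∑[ g < m ] ((r g - K) * (r g - K + 0ℤ))
    ≡⟨ sum-cong-≗ (λ g → cong (_*_ (r g - K)) (ℤP.+-identityʳ (r g - K))) ⟩
  ∑[ g < m ] ((r g - K) * (r g - K))
    ∎
  where
  open ℤP.≤-Reasoning
  M = + m
  E = ∑[ g < m ] (r g * r g)
  t : Fin m → ℤ
  t g = (s g - K) * (s g - K + 1ℤ)
  complete-square : ∀ N K M → K * M - (+ 2 * K - 1ℤ) * N + K * K - K ≡ (N - K) * (N - K + 1ℤ) + (K * M - N * N)
  complete-square = solve-∀
  recombine : ∀ E N K M → E + (1ℤ - + 2 * K) * (N * N) + (K * K - 1ℤ * K) * M + (K * M - N * N)
                          ≡ E + (0ℤ - + 2 * K) * (N * N) + (K * K - 0ℤ * K) * M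
  recombine = solve-∀

Σℤ-Fin≡∑ : ∀ m (f : Fin m → ℤ) → Σℤ-Fin m f ≡ ∑[ i < m ] f i
Σℤ-Fin≡∑ ℕ.zero    f = refl
Σℤ-Fin≡∑ (ℕ.suc m) f = cong (_+_ (f zero)) (begin
  foldr _+_ 0ℤ (map f (tabulate suc))  ≡⟨ cong (foldr _+_ 0ℤ) (map-tabulate suc f) ⟩
  foldr _+_ 0ℤ (tabulate (f ∘ suc))    ≡⟨ cong (foldr _+_ 0ℤ) (map-tabulate (λ i → i) (f ∘ suc)) ⟨
  Σℤ-Fin m (f ∘ suc)                   ≡⟨ Σℤ-Fin≡∑ m (f ∘ suc) ⟩
  ∑[ i < m ] f (suc i)                 ∎)
  where open ≡-Reasoning

pos-sum : ∀ (ns : List ℕ) → + List.sum ns ≡ foldr _+_ 0ℤ (map +_ ns)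
pos-sum []       = refl
pos-sum (n ∷ ns) = trans (ℤP.pos-+ n (List.sum ns)) (cong (_+_ (+ n)) (pos-sum ns))

pos-Σ-Fin : ∀ m (f : Fin m → ℕ) → + Σ-Fin m f ≡ ∑[ i < m ] (+ f i)
pos-Σ-Fin m f = begin
  + Σ-Fin m f                                ≡⟨ pos-sum (map f (allFin m)) ⟩
  foldr _+_ 0ℤ (map +_ (map f (allFin m)))   ≡⟨ cong (foldr _+_ 0ℤ) (map-∘ (allFin m)) ⟨
  Σℤ-Fin m (+_ ∘ f)                          ≡⟨ Σℤ-Fin≡∑ m (+_ ∘ f) ⟩
  ∑[ i < m ] (+ f i)                         ∎
  where open ≡-Reasoning

pos-R : ∀ {m} (u : Fin m → Fin m → Fin m) (A : Subset m) (g : Fin m) →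
  + R u A g ≡ Representation.rep (χ ∘ lookup A) u g
pos-R {m} u A g = trans (pos-Σ-Fin m _) (sum-cong-≗ λ a → trans (pos-Σ-Fin m _) (sum-cong-≗ λ b →
  χ-∧∧ (lookup A a) (lookup A b) ⌊ u a b ≟ g ⌋))
  where
  χ-∧∧ : ∀ x y z → χ (x ∧ y ∧ z) ≡ χ x * χ y * χ z
  χ-∧∧ x y z = trans (χ-∧ x (y ∧ z)) (trans (cong (_*_ (χ x)) (χ-∧ y z)) (sym (ℤP.*-assoc (χ x) (χ y) (χ z))))

pos-∣∣ : ∀ {m} (A : Subset m) → + ∣ A ∣ ≡ ∑[ a < m ] χ (lookup A a)
pos-∣∣ Vec.[]          = refl
pos-∣∣ (true  Vec.∷ A) = cong (_+_ 1ℤ) (pos-∣∣ A)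
pos-∣∣ (false Vec.∷ A) = trans (pos-∣∣ A) (sym (ℤP.+-identityˡ _))

pos-2*-∸1 : ∀ {k} → 1 ≤ k → + (2 ℕ.* k ∸ 1) ≡ + 2 * + k - 1ℤ
pos-2*-∸1 {k} 1≤k = begin
  + (2 ℕ.* k ∸ 1)   ≡⟨ ℤP.⊖-≥ (ℕP.≤-trans 1≤k (ℕP.m≤n*m k 2)) ⟨
  2 ℕ.* k ℤ.⊖ 1     ≡⟨ ℤP.m-n≡m⊖n (2 ℕ.* k) 1 ⟨
  + (2 ℕ.* k) - 1ℤ  ≡⟨ cong (_- 1ℤ) (ℤP.pos-* 2 k) ⟩
  + 2 * + k - 1ℤ    ∎
  where open ≡-Reasoning

lemma2p3 : (m : ℕ) (_⊕_ : Fin m → Fin m → Fin m) (0# : Fin m) (⊖_ : Fin m → Fin m)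
    → IsAbelianGroup _≡_ _⊕_ 0# ⊖_
    → (A : Subset m) (k : ℕ) → 1 ≤ k
    → (+ (k ℕ.* m)) - (+ (2 ℕ.* k ∸ 1)) * (+ ∣ A ∣) + (+ (k ℕ.* k)) - (+ k)
      ℤ.≤ Σℤ-Fin m (λ g → ((+ R _⊕_ A g) - (+ k)) * ((+ R _⊕_ A g) - (+ k)))
lemma2p3 m _⊕_ 0# ⊖_ isAbelianGroup A k 1≤k = begin
  + (k ℕ.* m) - + (2 ℕ.* k ∸ 1) * + ∣ A ∣ + + (k ℕ.* k) - K
    ≡⟨ cong₂ (λ x y → x + y - K) (cong₂ _-_ (ℤP.pos-* k m) (cong₂ _*_ (pos-2*-∸1 1≤k) (pos-∣∣ A))) (ℤP.pos-* k k) ⟩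
  K * + m - (+ 2 * K - 1ℤ) * N + K * K - K
    ≤⟨ sq-deviation-bound (rep _⊕_) (rep _//_) N K 0# (∑-rep _⊕_) (∑-rep _//_) ∑rep∙²≡∑rep//² rep-//-0# ⟩
  ∑[ g < m ] ((rep _⊕_ g - K) * (rep _⊕_ g - K))
    ≡⟨ sum-cong-≗ (λ g → cong (λ x → (x - K) * (x - K)) (pos-R _⊕_ A g)) ⟨
  ∑[ g < m ] ((+ R _⊕_ A g - K) * (+ R _⊕_ A g - K))
    ≡⟨ Σℤ-Fin≡∑ m _ ⟨
  Σℤ-Fin m (λ g → (+ R _⊕_ A g - K) * (+ R _⊕_ A g - K))
    ∎
  where
  open ℤP.≤-Reasoning
  w : Fin m → ℤ
  w = χ ∘ lookup A
  open Representation w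
  open Difference isAbelianGroup w
  K = + k
  N = sum w
  rep-//-0# : rep _//_ 0# ≡ N
  rep-//-0# = trans rep-//-ε (sum-cong-≗ (χ-idem ∘ lookup A))
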